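{- For every $\pi\in\mathrm{Av}(231)$, the trees $\mathrm{T}_{\mathrm{in}}(\pi)$ and $\mathrm{T}_{\mathrm{in}}(P(\pi))$ have the same underlying unlabelled binary tree.
   Context: The bijection $P$. - $\mathrm{Av}(231)$ (resp. $\mathrm{Av}(132)$) is the set of permutations avoiding $231$ (resp. $132$). - $\alpha\oplus\beta=\alpha(\beta+|\alpha|)$ and $\alpha\ominus\beta=(\alpha+|\beta|)\beta$. - Every nonempty $\pi\in\mathrm{Av}(231)$ is uniquely $\alpha\oplus(1\ominus\beta)$ with $\alpha,\beta\in\mathrm{Av}(231)$. - $P:\mathrm{Av}(231)\to\mathrm{Av}(132)$ is defined by $P(\varepsilon)=\varepsilon$ and $P(\alpha\oplus(1\ominus\beta))=(P(\alpha)\oplus1)\ominus P(\beta)$. Trees. - A binary tree is decreasing if every child's label is smaller than its parent's. - The in-order reading is (left subtree reading)(root)(right subtree reading). - $\mathrm{T}_{\mathrm{in}}(\pi)$ is the unique decreasing binary tree with in-order reading $\pi$. Recursively, $\mathrm{T}_{\mathrm{in}}(\alpha n\beta)$ has root $n$ (the maximum), left subtree $\mathrm{T}_{\mathrm{in}}(\alpha)$ and right subtree $\mathrm{T}_{\mathrm{in}}(\beta)$. -}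

module Defs where

open import Data.Nat using (ℕ; zero; suc; _+_; _∸_; _<_; _⊔_)
open import Data.Nat.Properties using (_≟_)
open import Data.List using (List; []; _∷_; _++_; map; length; upTo; foldr)
open import Data.List.Relation.Binary.Sublist.Propositional using (_⊆_)
open import Data.List.Relation.Binary.Permutation.Propositional using (_↭_)
open import Data.Product using (Σ; ∃; _×_; _,_)
open import Relation.Nullary using (¬_; yes; no)

-- Permutations of [n] = {1,…,n} in one-line notation, as lists of naturals.
IsPerm : List ℕ → Set
IsPerm π = π ↭ map suc (upTo (length π))

Contains231 : List ℕ → Set
Contains231 π = ∃ λ a → ∃ λ b → ∃ λ c →
  ((a ∷ b ∷ c ∷ []) ⊆ π) × (c < a) × (a < b)

Av231 : List ℕ → Set
Av231 π = IsPerm π × ¬ Contains231 π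

_⊕_ : List ℕ → List ℕ → List ℕ
α ⊕ β = α ++ map (_+ length α) β

_⊖_ : List ℕ → List ℕ → List ℕ
α ⊖ β = map (_+ length β) α ++ β

maxL : List ℕ → ℕ
maxL = foldr _⊔_ 0

splitOn : ℕ → List ℕ → List ℕ × List ℕ
splitOn n [] = [] , []
splitOn n (x ∷ xs) with x ≟ n
... | yes _ = [] , xs
... | no _ with splitOn n xs
...   | (l , r) = x ∷ l , r

-- The bijection P, with fuel (fuel ≥ length suffices).
-- For nonempty π ∈ Av(231) of length n, π = α ⊕ (1 ⊖ β) where α is the
-- prefix before the maximum n, and β is the suffix after n, shifted down by |α|.
P-fuel : ℕ → List ℕ → List ℕ
P-fuel zero π = []
P-fuel (suc f) [] = []
P-fuel (suc f) π@(_ ∷ _) with splitOn (maxL π) π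
... | (α , suf) = (P-fuel f α ⊕ (1 ∷ [])) ⊖ P-fuel f (map (_∸ length α) suf)

P : List ℕ → List ℕ
P π = P-fuel (length π) π

data Tree (A : Set) : Set where
  leaf : Tree A
  node : Tree A → A → Tree A → Tree A

data Shape : Set where
  leaf : Shape
  node : Shape → Shape → Shape

shape : {A : Set} → Tree A → Shape
shape leaf = leaf
shape (node l _ r) = node (shape l) (shape r)

Tin-fuel : ℕ → List ℕ → Tree ℕ
Tin-fuel zero π = leaf
Tin-fuel (suc f) [] = leaf
Tin-fuel (suc f) π@(_ ∷ _) with splitOn (maxL π) π
... | (l , r) = node (Tin-fuel f l) (maxL π) (Tin-fuel f r)

Tin : List ℕ → Tree ℕ
Tin π = Tin-fuel (length π) π

-- Both T_in and P decompose a permutation at its maximum: π = α n β′.  If π avoids 231,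
-- every entry of α is below every entry of β′ (otherwise a n c is a 231), so by pigeonhole
-- β′ is a copy β of a smaller 231-avoider shifted up by |α|, and T_in π has shape
-- node (T_in α) (T_in β), shifting being invisible to shapes.  In P π = (P α ⊕ 1) ⊖ P β the
-- new maximum sits right after the shifted copy of P α, because P only produces entries
-- bounded by the length; hence T_in (P π) has shape node (T_in (P α)) (T_in (P β)), and
-- induction on the length concludes.
module Submission where

open import Defs
open import Data.Nat using (ℕ)
open import Data.List using (List)
open import Relation.Binary.PropositionalEquality using (_≡_)

open import Data.Nat using (zero; suc; _+_; _∸_; _<_; _≤_; z≤n; s≤s)
open import Data.Nat.Properties
open import Data.List using ([]; _∷_; _++_; map; length; filter)
open import Data.List.Properties
  using (length-++; length-map; map-++; map-∘; map-id-local; ++-assoc; filter-all; filter-accept; filter-reject)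
open import Data.List.Relation.Unary.All as All using (All; []; _∷_)
import Data.List.Relation.Unary.All.Properties as AllP
open import Data.List.Relation.Unary.AllPairs as AllPairs using (AllPairs; []; _∷_)
open import Data.List.Relation.Unary.Any using (here; there)
open import Data.List.Membership.Propositional using (_∈_)
open import Data.List.Membership.Propositional.Properties using (∈-++⁺ʳ)
open import Data.List.Relation.Unary.Unique.Propositional using (Unique)
import Data.List.Relation.Unary.Unique.Propositional.Properties as UniqueP
open import Data.List.Relation.Binary.Sublist.Propositional
  using (_⊆_; _∷_; _∷ʳ_; ⊆-refl; ⊆-trans; from∈)
open import Data.List.Relation.Binary.Sublist.Propositional.Properties using (++⁺; ++⁺ˡ; ++⁺ʳ; map⁺)
open import Data.List.Relation.Binary.Permutation.Propositional using (↭-sym; ↭⇒↭ₛ)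
open import Data.List.Relation.Binary.Permutation.Setoid.Properties using (Unique-resp-↭)
open import Data.Product using (∃₂; _×_; _,_; proj₁; proj₂)
open import Data.Sum using (inj₁; inj₂)
open import Data.Empty using (⊥-elim)
open import Function using (_∘_)
open import Relation.Nullary using (¬_; Dec; yes; no; ¬?)
open import Relation.Binary.PropositionalEquality
  using (_≢_; refl; sym; trans; cong; cong₂; subst; setoid; ≢-sym; module ≡-Reasoning)
open import Relation.Binary.Definitions using (tri<; tri≈; tri>)

Contains231-⊆ : ∀ {xs ys} → xs ⊆ ys → Contains231 xs → Contains231 ys
Contains231-⊆ xs⊆ys (a , b , c , abc⊆xs , c<a , a<b) = a , b , c , ⊆-trans abc⊆xs xs⊆ys , c<a , a<b

Contains231-map-+ : ∀ k {xs} → Contains231 xs → Contains231 (map (_+ k) xs)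
Contains231-map-+ k (a , b , c , abc⊆xs , c<a , a<b) =
  a + k , b + k , c + k , map⁺ (_+ k) abc⊆xs , +-monoˡ-< k c<a , +-monoˡ-< k a<b

AllPairs-++⁻ : ∀ {A : Set} {R : A → A → Set} xs {ys} → AllPairs R (xs ++ ys) →
  AllPairs R xs × AllPairs R ys × All (λ x → All (R x) ys) xs
AllPairs-++⁻ []       Rys             = [] , Rys , []
AllPairs-++⁻ (x ∷ xs) (Rxxsys ∷ Rxsys) with AllPairs-++⁻ xs Rxsys
... | Rxs , Rys , Rxsys′ = AllP.++⁻ˡ xs Rxxsys ∷ Rxs , Rys , AllP.++⁻ʳ xs Rxxsys ∷ Rxsys′

IsPerm⇒Unique : ∀ {π} → IsPerm π → Unique π
IsPerm⇒Unique {π} π↭ =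
  Unique-resp-↭ (setoid ℕ) (↭⇒↭ₛ (↭-sym π↭)) (UniqueP.map⁺ suc-injective (UniqueP.upTo⁺ (length π)))

_≢?_ : (x y : ℕ) → Dec (x ≢ y)
x ≢? y = ¬? (x ≟ y)

length≤1+length-filter≢ : ∀ c {xs} → Unique xs → length xs ≤ suc (length (filter (_≢? c) xs))
length≤1+length-filter≢ c {[]} _ = z≤n
length≤1+length-filter≢ c {x ∷ xs} (x∉xs ∷ u) with x ≟ c
... | yes refl = begin
  suc (length xs)                         ≡⟨ cong (suc ∘ length) (filter-all (_≢? c) (All.map ≢-sym x∉xs)) ⟨
  suc (length (filter (_≢? c) xs))        ≡⟨ cong (suc ∘ length) (filter-reject (_≢? c) (λ c≢c → c≢c refl)) ⟨
  suc (length (filter (_≢? c) (c ∷ xs)))  ∎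
  where open ≤-Reasoning
... | no x≢c = begin
  suc (length xs)                         ≤⟨ s≤s (length≤1+length-filter≢ c u) ⟩
  suc (suc (length (filter (_≢? c) xs)))  ≡⟨ cong (suc ∘ length) (filter-accept (_≢? c) x≢c) ⟨
  suc (length (filter (_≢? c) (x ∷ xs)))  ∎
  where open ≤-Reasoning

Unique∧All<⇒length≤ : ∀ c {xs} → Unique xs → All (_< c) xs → length xs ≤ c
Unique∧All<⇒length≤ zero    {[]} _ [] = z≤n
Unique∧All<⇒length≤ (suc c) {xs} u xs<1+c = ≤-trans (length≤1+length-filter≢ c u)
  (s≤s (Unique∧All<⇒length≤ c (UniqueP.filter⁺ (_≢? c) u) (All.zipWith below-c (filtered<1+c , filtered≢c))))
  where
  below-c : ∀ {y} → y < suc c × y ≢ c → y < c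
  below-c (y<1+c , y≢c) = ≤∧≢⇒< (≤-pred y<1+c) y≢c
  filtered<1+c : All (_< suc c) (filter (_≢? c) xs)
  filtered<1+c = AllP.filter⁺ (_≢? c) xs<1+c
  filtered≢c : All (_≢ c) (filter (_≢? c) xs)
  filtered≢c = AllP.all-filter (_≢? c) xs

∈⇒≤maxL : ∀ {x xs} → x ∈ xs → x ≤ maxL xs
∈⇒≤maxL {xs = y ∷ ys} (here refl)  = m≤m⊔n y (maxL ys)
∈⇒≤maxL {xs = y ∷ ys} (there x∈ys) = ≤-trans (∈⇒≤maxL x∈ys) (m≤n⊔m y (maxL ys))

maxL≤ : ∀ {m xs} → All (_≤ m) xs → maxL xs ≤ m
maxL≤ []           = z≤n
maxL≤ (x≤m ∷ xs≤m) = ⊔-lub x≤m (maxL≤ xs≤m)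

maxL∈ : ∀ x xs → maxL (x ∷ xs) ∈ x ∷ xs
maxL∈ x []       = here (⊔-identityʳ x)
maxL∈ x (y ∷ ys) with ⊔-sel x (maxL (y ∷ ys))
... | inj₁ x⊔ys≡x  = here x⊔ys≡x
... | inj₂ x⊔ys≡ys = there (subst (_∈ y ∷ ys) (sym x⊔ys≡ys) (maxL∈ y ys))

splitOn-++ : ∀ {n} l r → All (_≢ n) l → splitOn n (l ++ n ∷ r) ≡ (l , r)
splitOn-++ {n} [] r [] with n ≟ n
... | yes _  = refl
... | no n≢n = ⊥-elim (n≢n refl)
splitOn-++ {n} (x ∷ l) r (x≢n ∷ l≢n) with x ≟ n
... | yes x≡n = ⊥-elim (x≢n x≡n)
... | no _ rewrite splitOn-++ l r l≢n = refl

∈⇒first-split : ∀ {n xs} → n ∈ xs → ∃₂ λ l r → xs ≡ l ++ n ∷ r × All (_≢ n) l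
∈⇒first-split {n} {x ∷ xs} n∈x∷xs with x ≟ n | n∈x∷xs
... | yes refl | _          = [] , xs , refl , []
... | no x≢n   | here n≡x   = ⊥-elim (x≢n (sym n≡x))
... | no x≢n   | there n∈xs with ∈⇒first-split n∈xs
...   | l , r , refl , l≢n  = x ∷ l , r , refl , x≢n ∷ l≢n

LeftmostMax : List ℕ → ℕ → List ℕ → Set
LeftmostMax l m r = All (_< m) l × All (_≤ m) r

LeftmostMax⇒All≤ : ∀ {l m r} → LeftmostMax l m r → All (_≤ m) (l ++ m ∷ r)
LeftmostMax⇒All≤ (l<m , r≤m) = AllP.++⁺ (All.map <⇒≤ l<m) (≤-refl ∷ r≤m)

maxL-leftmostMax : ∀ {l m r} → LeftmostMax l m r → maxL (l ++ m ∷ r) ≡ m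
maxL-leftmostMax {l} lm = ≤-antisym (maxL≤ (LeftmostMax⇒All≤ lm)) (∈⇒≤maxL (∈-++⁺ʳ l (here refl)))

splitOn-leftmostMax : ∀ {l m r} → LeftmostMax l m r → splitOn m (l ++ m ∷ r) ≡ (l , r)
splitOn-leftmostMax {l} {r = r} (l<m , _) = splitOn-++ l r (All.map <⇒≢ l<m)

LeftmostMax-map-+ : ∀ k {l m r} → LeftmostMax l m r → LeftmostMax (map (_+ k) l) (m + k) (map (_+ k) r)
LeftmostMax-map-+ k (l<m , r≤m) = AllP.map⁺ (All.map (+-monoˡ-< k) l<m) , AllP.map⁺ (All.map (+-monoˡ-≤ k) r≤m)

data MaxView : List ℕ → Set where
  empty : MaxView []
  split : ∀ {l m r} → LeftmostMax l m r → MaxView (l ++ m ∷ r)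

maxView : ∀ xs → MaxView xs
maxView []       = empty
maxView (x ∷ xs) with ∈⇒first-split (maxL∈ x xs)
... | l , r , x∷xs≡l++m∷r , l≢m = subst MaxView (sym x∷xs≡l++m∷r) (split (l<m , r≤m))
  where
  m : ℕ
  m = maxL (x ∷ xs)
  l++m∷r≤m : All (_≤ m) (l ++ m ∷ r)
  l++m∷r≤m = subst (All (_≤ m)) x∷xs≡l++m∷r (All.tabulate ∈⇒≤maxL)
  l<m : All (_< m) l
  l<m = All.zipWith (λ (x≤m , x≢m) → ≤∧≢⇒< x≤m x≢m) (AllP.++⁻ˡ l l++m∷r≤m , l≢m)
  r≤m : All (_≤ m) r
  r≤m = All.tail (AllP.++⁻ʳ l l++m∷r≤m)

length-++-∷ : ∀ l {m : ℕ} r → length (l ++ m ∷ r) ≡ suc (length l + length r)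
length-++-∷ l r = trans (length-++ l) (+-suc (length l) (length r))

length-++-∷≤ : ∀ l {m : ℕ} r {f} → length (l ++ m ∷ r) ≤ suc f → length l ≤ f × length r ≤ f
length-++-∷≤ l r {f} len≤1+f =
  ≤-trans (m≤m+n (length l) (length r)) len≤f , ≤-trans (m≤n+m (length r) (length l)) len≤f
  where
  len≤f : length l + length r ≤ f
  len≤f = ≤-pred (subst (_≤ suc f) (length-++-∷ l r) len≤1+f)

Tin-fuel-∷ : ∀ f {x xs l m r} → maxL (x ∷ xs) ≡ m → splitOn m (x ∷ xs) ≡ (l , r) →
  Tin-fuel (suc f) (x ∷ xs) ≡ node (Tin-fuel f l) m (Tin-fuel f r)
Tin-fuel-∷ f refl split≡ = cong (λ (l , r) → node (Tin-fuel f l) _ (Tin-fuel f r)) split≡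

Tin-fuel-++ : ∀ f {l m r} → LeftmostMax l m r →
  Tin-fuel (suc f) (l ++ m ∷ r) ≡ node (Tin-fuel f l) m (Tin-fuel f r)
Tin-fuel-++ f {[]}    lm = Tin-fuel-∷ f (maxL-leftmostMax lm) (splitOn-leftmostMax lm)
Tin-fuel-++ f {_ ∷ _} lm = Tin-fuel-∷ f (maxL-leftmostMax lm) (splitOn-leftmostMax lm)

Tin-fuel-irrelevant : ∀ f g xs → length xs ≤ f → length xs ≤ g → Tin-fuel f xs ≡ Tin-fuel g xs
Tin-fuel-irrelevant zero    zero    _       _  _  = refl
Tin-fuel-irrelevant zero    (suc _) []      _  _  = refl
Tin-fuel-irrelevant (suc _) zero    []      _  _  = refl
Tin-fuel-irrelevant (suc f) (suc g) xs len≤f len≤g with maxView xs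
... | empty = refl
... | split {l} {m} {r} lm
  with l≤f , r≤f ← length-++-∷≤ l r len≤f
     | l≤g , r≤g ← length-++-∷≤ l r len≤g = begin
  Tin-fuel (suc f) (l ++ m ∷ r)     ≡⟨ Tin-fuel-++ f lm ⟩
  node (Tin-fuel f l) m (Tin-fuel f r)
    ≡⟨ cong₂ (λ t u → node t m u) (Tin-fuel-irrelevant f g l l≤f l≤g) (Tin-fuel-irrelevant f g r r≤f r≤g) ⟩
  node (Tin-fuel g l) m (Tin-fuel g r) ≡⟨ Tin-fuel-++ g lm ⟨
  Tin-fuel (suc g) (l ++ m ∷ r)     ∎
  where open ≡-Reasoning

Tin-++ : ∀ {l m r} → LeftmostMax l m r → Tin (l ++ m ∷ r) ≡ node (Tin l) m (Tin r)
Tin-++ {l} {m} {r} lm = begin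
  Tin (l ++ m ∷ r)                      ≡⟨ cong (λ f → Tin-fuel f (l ++ m ∷ r)) (length-++-∷ l r) ⟩
  Tin-fuel (suc n) (l ++ m ∷ r)         ≡⟨ Tin-fuel-++ n lm ⟩
  node (Tin-fuel n l) m (Tin-fuel n r)
    ≡⟨ cong₂ (λ t u → node t m u) (Tin-fuel-irrelevant n _ l (m≤m+n _ _) ≤-refl)
                                   (Tin-fuel-irrelevant n _ r (m≤n+m _ _) ≤-refl) ⟩
  node (Tin l) m (Tin r)                ∎
  where
  open ≡-Reasoning
  n : ℕ
  n = length l + length r

shape-Tin-fuel-map-+ : ∀ k f xs → shape (Tin-fuel f (map (_+ k) xs)) ≡ shape (Tin-fuel f xs)
shape-Tin-fuel-map-+ k zero    xs = refl
shape-Tin-fuel-map-+ k (suc f) xs with maxView xs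
... | empty = refl
... | split {l} {m} {r} lm rewrite map-++ (_+ k) l (m ∷ r) = begin
  shape (Tin-fuel (suc f) (map (_+ k) l ++ (m + k) ∷ map (_+ k) r))
    ≡⟨ cong shape (Tin-fuel-++ f (LeftmostMax-map-+ k lm)) ⟩
  node (shape (Tin-fuel f (map (_+ k) l))) (shape (Tin-fuel f (map (_+ k) r)))
    ≡⟨ cong₂ node (shape-Tin-fuel-map-+ k f l) (shape-Tin-fuel-map-+ k f r) ⟩
  node (shape (Tin-fuel f l)) (shape (Tin-fuel f r))
    ≡⟨ cong shape (Tin-fuel-++ f lm) ⟨
  shape (Tin-fuel (suc f) (l ++ m ∷ r)) ∎
  where open ≡-Reasoning

shape-Tin-map-+ : ∀ k xs → shape (Tin (map (_+ k) xs)) ≡ shape (Tin xs)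
shape-Tin-map-+ k xs rewrite length-map (_+ k) xs = shape-Tin-fuel-map-+ k (length xs) xs

BoundedByLength : List ℕ → Set
BoundedByLength xs = All (_≤ length xs) xs

⊕1⊖-decomposition : ∀ α β →
  (α ⊕ (1 ∷ [])) ⊖ β ≡ map (_+ length β) α ++ suc (length α + length β) ∷ β
⊕1⊖-decomposition α β = begin
  map (_+ b) (α ++ suc a ∷ []) ++ β       ≡⟨ cong (_++ β) (map-++ (_+ b) α (suc a ∷ [])) ⟩
  (map (_+ b) α ++ suc a + b ∷ []) ++ β   ≡⟨ ++-assoc (map (_+ b) α) (suc a + b ∷ []) β ⟩
  map (_+ b) α ++ suc (a + b) ∷ β         ∎
  where
  open ≡-Reasoning
  a : ℕ
  a = length α
  b : ℕ
  b = length β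

⊕1⊖-leftmostMax : ∀ {α β} → BoundedByLength α → BoundedByLength β →
  LeftmostMax (map (_+ length β) α) (suc (length α + length β)) β
⊕1⊖-leftmostMax {α} {β} α≤a β≤b =
  AllP.map⁺ (All.map (λ x≤a → s≤s (+-monoˡ-≤ (length β) x≤a)) α≤a) ,
  All.map (λ y≤b → ≤-trans y≤b (≤-trans (m≤n+m (length β) (length α)) (n≤1+n _))) β≤b

⊕1⊖-boundedByLength : ∀ {α β} → BoundedByLength α → BoundedByLength β →
  BoundedByLength ((α ⊕ (1 ∷ [])) ⊖ β)
⊕1⊖-boundedByLength {α} {β} α≤a β≤b =
  subst BoundedByLength (sym (⊕1⊖-decomposition α β))
    (subst (λ n → All (_≤ n) (L ++ N ∷ β)) (sym length≡N) (LeftmostMax⇒All≤ (⊕1⊖-leftmostMax α≤a β≤b)))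
  where
  L : List ℕ
  L = map (_+ length β) α
  N : ℕ
  N = suc (length α + length β)
  length≡N : length (L ++ N ∷ β) ≡ N
  length≡N = trans (length-++-∷ L β) (cong (λ n → suc (n + length β)) (length-map _ α))

shape-Tin-⊕1⊖ : ∀ {α β} → BoundedByLength α → BoundedByLength β →
  shape (Tin ((α ⊕ (1 ∷ [])) ⊖ β)) ≡ node (shape (Tin α)) (shape (Tin β))
shape-Tin-⊕1⊖ {α} {β} α≤a β≤b rewrite ⊕1⊖-decomposition α β =
  trans (cong shape (Tin-++ (⊕1⊖-leftmostMax α≤a β≤b)))
        (cong (λ t → node t (shape (Tin β))) (shape-Tin-map-+ (length β) α))

P-fuel-boundedByLength : ∀ f xs → BoundedByLength (P-fuel f xs)
P-fuel-boundedByLength zero    _        = []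
P-fuel-boundedByLength (suc f) []       = []
P-fuel-boundedByLength (suc f) (x ∷ xs) with splitOn (maxL (x ∷ xs)) (x ∷ xs)
... | l , r = ⊕1⊖-boundedByLength (P-fuel-boundedByLength f l)
                                  (P-fuel-boundedByLength f (map (_∸ length l) r))

P-fuel-∷ : ∀ f {x xs l m r} → maxL (x ∷ xs) ≡ m → splitOn m (x ∷ xs) ≡ (l , r) →
  P-fuel (suc f) (x ∷ xs) ≡ (P-fuel f l ⊕ (1 ∷ [])) ⊖ P-fuel f (map (_∸ length l) r)
P-fuel-∷ f refl split≡ =
  cong (λ (l , r) → (P-fuel f l ⊕ (1 ∷ [])) ⊖ P-fuel f (map (_∸ length l) r)) split≡

P-fuel-++ : ∀ f {l m r} → LeftmostMax l m r →
  P-fuel (suc f) (l ++ m ∷ r) ≡ (P-fuel f l ⊕ (1 ∷ [])) ⊖ P-fuel f (map (_∸ length l) r)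
P-fuel-++ f {[]}    lm = P-fuel-∷ f (maxL-leftmostMax lm) (splitOn-leftmostMax lm)
P-fuel-++ f {_ ∷ _} lm = P-fuel-∷ f (maxL-leftmostMax lm) (splitOn-leftmostMax lm)

Av231-left<right : ∀ {l m r} → Unique (l ++ m ∷ r) → ¬ Contains231 (l ++ m ∷ r) → All (_< m) l →
  All (λ c → All (_< c) l) r
Av231-left<right {l} {m} {r} u avoids l<m = All.tabulate λ c∈r → All.tabulate λ a∈l → a<c a∈l c∈r
  where
  l∉m∷r : All (λ a → All (a ≢_) (m ∷ r)) l
  l∉m∷r = proj₂ (proj₂ (AllPairs-++⁻ l u))
  a<c : ∀ {a c} → a ∈ l → c ∈ r → a < c
  a<c {a} {c} a∈l c∈r with <-cmp a c
  ... | tri< a<c _ _ = a<c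
  ... | tri≈ _ a≡c _ = ⊥-elim (All.lookup (All.lookup l∉m∷r a∈l) (there c∈r) a≡c)
  ... | tri> _ _ c<a =
    ⊥-elim (avoids (a , m , c , ++⁺ (from∈ a∈l) (refl ∷ from∈ c∈r) , c<a , All.lookup l<m a∈l))

shape-Tin-P-fuel : ∀ f π → length π ≤ f → Unique π → ¬ Contains231 π →
  shape (Tin π) ≡ shape (Tin (P-fuel f π))
shape-Tin-P-fuel zero    []      _  _ _ = refl
shape-Tin-P-fuel (suc f) π len≤f u avoids with maxView π
... | empty = refl
... | split {l} {m} {r} lm@(l<m , _) = begin
  shape (Tin (l ++ m ∷ r))                                ≡⟨ cong shape (Tin-++ lm) ⟩
  node (shape (Tin l)) (shape (Tin r))                    ≡⟨ cong (node _ ∘ shape ∘ Tin) β+k≡r ⟨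
  node (shape (Tin l)) (shape (Tin (map (_+ k) β)))       ≡⟨ cong (node _) (shape-Tin-map-+ k β) ⟩
  node (shape (Tin l)) (shape (Tin β))
    ≡⟨ cong₂ node (shape-Tin-P-fuel f l l≤f ul avoidsˡ) (shape-Tin-P-fuel f β β≤f uβ avoidsβ) ⟩
  node (shape (Tin (P-fuel f l))) (shape (Tin (P-fuel f β)))
    ≡⟨ shape-Tin-⊕1⊖ (P-fuel-boundedByLength f l) (P-fuel-boundedByLength f β) ⟨
  shape (Tin ((P-fuel f l ⊕ (1 ∷ [])) ⊖ P-fuel f β))      ≡⟨ cong (shape ∘ Tin) (P-fuel-++ f lm) ⟨
  shape (Tin (P-fuel (suc f) (l ++ m ∷ r)))               ∎
  where
  open ≡-Reasoning
  k : ℕ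
  k = length l
  β : List ℕ
  β = map (_∸ k) r
  ul : Unique l
  ul = proj₁ (AllPairs-++⁻ l u)
  ur : Unique r
  ur = AllPairs.tail (proj₁ (proj₂ (AllPairs-++⁻ l u)))
  -- Each entry of r exceeds the |l| distinct entries of l, hence is at least |l| by pigeonhole.
  β+k≡r : map (_+ k) β ≡ r
  β+k≡r = trans (sym (map-∘ r)) (map-id-local (All.map (λ l<c → m∸n+n≡m (Unique∧All<⇒length≤ _ ul l<c))
                                                       (Av231-left<right u avoids l<m)))
  l≤f : length l ≤ f
  l≤f = proj₁ (length-++-∷≤ l r len≤f)
  β≤f : length β ≤ f
  β≤f = subst (_≤ f) (sym (length-map (_∸ k) r)) (proj₂ (length-++-∷≤ l r len≤f))
  uβ : Unique β
  uβ = UniqueP.map⁻ (subst Unique (sym β+k≡r) ur)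
  avoidsˡ : ¬ Contains231 l
  avoidsˡ = avoids ∘ Contains231-⊆ (++⁺ʳ (m ∷ r) ⊆-refl)
  avoidsβ : ¬ Contains231 β
  avoidsβ = avoids ∘ Contains231-⊆ (++⁺ˡ l (m ∷ʳ ⊆-refl)) ∘ subst Contains231 β+k≡r ∘ Contains231-map-+ k

mainTheorem12 : (π : List ℕ) → Av231 π → shape (Tin π) ≡ shape (Tin (P π))
mainTheorem12 π (isPerm , avoids) = shape-Tin-P-fuel (length π) π ≤-refl (IsPerm⇒Unique isPerm) avoids
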